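{- Let $b_n$ be the number of even permutations in $\mathscr{G}_n$. Then $b_1=1$, $b_2=1$, and \[ b_n=2b_{n-2}+2^{n-2}+n-4\quad\text{for } n>2. \]
   Context: A permutation is Grassmannian if it has at most one descent (a position $i$ with $\pi(i)>\pi(i+1)$); $\mathscr{G}_n$ is the set of Grassmannian permutations of $[n]$. A permutation is even if its number of inversions (pairs $i<j$ with $\pi(i)>\pi(j)$) is even. -}

module Defs where

open import Data.Nat using (ℕ; zero; suc; _+_; _<ᵇ_; _≡ᵇ_)
open import Data.Nat.Properties using ()
open import Data.Bool using (Bool; true; false; _∧_; not; if_then_else_)
open import Data.Fin using (Fin; toℕ)
open import Data.List using (List; []; _∷_; map; concatMap; filter; length; allFin)
open import Data.Vec using (Vec; []; _∷_; toList)
open import Relation.Nullary.Decidable using (does)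
open import Data.Bool.Properties using (T?)
open import Function using (_∘_)

words : (n k : ℕ) → List (Vec (Fin n) k)
words n zero = [] ∷ []
words n (suc k) = concatMap (λ x → map (x ∷_) (words n k)) (allFin n)

allB : {A : Set} → (A → Bool) → List A → Bool
allB p [] = true
allB p (x ∷ xs) = p x ∧ allB p xs

distinct : {n : ℕ} → List (Fin n) → Bool
distinct [] = true
distinct (x ∷ xs) = allB (λ y → not (toℕ x ≡ᵇ toℕ y)) xs ∧ distinct xs

-- Permutations of [n] = {0,…,n-1} (0-based relabelling of [n]) in one-line notation.
perms : (n : ℕ) → List (Vec (Fin n) n)
perms n = filter (λ w → T? (distinct (toList w))) (words n n)

descentsL : {n : ℕ} → List (Fin n) → ℕ
descentsL [] = 0
descentsL (x ∷ []) = 0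
descentsL (x ∷ y ∷ xs) = (if toℕ y <ᵇ toℕ x then 1 else 0) + descentsL (y ∷ xs)

inversionsL : {n : ℕ} → List (Fin n) → ℕ
inversionsL [] = 0
inversionsL (x ∷ xs) = length (filter (λ y → T? (toℕ y <ᵇ toℕ x)) xs) + inversionsL xs

isEvenℕ : ℕ → Bool
isEvenℕ zero = true
isEvenℕ (suc n) = not (isEvenℕ n)

isGrassmannian : {n : ℕ} → Vec (Fin n) n → Bool
isGrassmannian w = descentsL (toList w) <ᵇ 2

isEvenPerm : {n : ℕ} → Vec (Fin n) n → Bool
isEvenPerm w = isEvenℕ (inversionsL (toList w))

b : ℕ → ℕ
b n = length (filter (λ w → T? (isGrassmannian w ∧ isEvenPerm w)) (perms n))

-- Every permutation of [m + 1] arises in exactly one way by inserting the largest value into a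
-- permutation of [m]. Inserting it at position p adds m − p inversions, creates a descent right after
-- it unless p = m, and keeps all old descents. So a Grassmannian permutation of [m + 1] comes either
-- from the identity (p arbitrary) or from a permutation with one descent, the new value going to
-- the end or exactly to the descent, which lengthens the first ascending run by one. Hence the
-- numbers of permutations of [m] with no descent, resp. one descent with given parities of the
-- inversion number and of the length of the first run, evolve by an explicit linear map depending on m.
-- Applying it twice gives b (m + 2) + 2 = 2 b m + (2 ^ m − m) + 2 m, where 2 ^ m − m is the number
-- of all Grassmannian permutations of [m].

module Submission where

open import Defs
open import Data.Bool using (Bool; true; false; not; _∧_; T; if_then_else_)
open import Data.Bool.Properties using (not-involutive; T-∧)
open import Data.Empty using (⊥-elim)
open import Data.Fin using (Fin; toℕ; fromℕ<)
open import Data.Fin.Properties using (toℕ-injective; toℕ<n; toℕ-fromℕ<)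
open import Data.List using (List; []; _∷_; _++_; [_]; map; length; take; drop; concatMap; applyUpTo; upTo; filter)
open import Data.List.Properties
  using (∷-injective; map-∘; map-cong; map-cong-local; map-++; map-injective; map-applyUpTo; applyUpTo-∷ʳ;
         ++-identityʳ; take++drop≡id; take-all; drop-all; length-map; length-take; length-drop; length-++;
         length-++-≤ˡ; length-upTo)
open import Data.List.Membership.Propositional using (_∈_; find; lose)
open import Data.List.Membership.Propositional.Properties
  using (∈-∃++; ∈-map⁺; ∈-map⁻; ∈-allFin; ∈-filter⁺; ∈-filter⁻; ∈-concatMap⁺; ∈-concatMap⁻;
         ∈-applyUpTo⁺; ∈-applyUpTo⁻; ∈-upTo⁺)
open import Data.List.Membership.Propositional.Properties.WithK using (unique∧set⇒bag)
open import Data.List.Relation.Binary.BagAndSetEquality using (∼bag⇒↭)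
open import Data.List.Relation.Binary.Permutation.Propositional using (_↭_)
import Data.List.Relation.Binary.Permutation.Propositional.Properties as ↭
open import Data.List.Relation.Unary.All as All using (All; []; _∷_)
import Data.List.Relation.Unary.All.Properties as All
open import Data.List.Relation.Unary.Any using (here; there)
import Data.List.Relation.Unary.Any.Properties as Any
open import Data.List.Relation.Unary.Unique.Propositional using (Unique; []; _∷_)
import Data.List.Relation.Unary.Unique.Propositional.Properties as Unique
open import Data.Maybe using (Maybe; just; nothing; maybe)
open import Data.Nat using (ℕ; zero; suc; _+_; _*_; _^_; _∸_; _>_; _≤_; _<_; z≤n; s≤s; s≤s⁻¹; z<s; s<s; _<ᵇ_; _≡ᵇ_; _≟_)
open import Data.List.Membership.DecPropositional _≟_ using (_∈?_)
open import Data.Nat.ListAction using (sum)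
open import Data.Nat.ListAction.Properties using (sum-++; sum-↭)
open import Data.Nat.Properties
open import Data.Nat.Tactic.RingSolver using (solve-∀)
open import Data.Product using (_×_; _,_; proj₁; proj₂)
open import Data.Sum using (inj₁; inj₂)
open import Data.Vec using (Vec; []; _∷_; toList)
import Data.Vec.Properties as Vec
open import Function using (_∘_)
open import Function.Bundles using (_⇔_; mk⇔; module Equivalence)
open import Relation.Binary using (tri<; tri≈; tri>)
open import Relation.Binary.PropositionalEquality hiding ([_])
open import Relation.Nullary using (¬_; yes; no)
open import Relation.Nullary.Decidable using (T?)
open import Algebra.Properties.CommutativeSemigroup +-commutativeSemigroup using (interchange)

indicator : Bool → ℕ
indicator true = 1
indicator false = 0

indicator-not : ∀ x → indicator x + indicator (not x) ≡ 1
indicator-not true = refl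
indicator-not false = refl

indicator≤1 : ∀ x → indicator x ≤ 1
indicator≤1 true = ≤-refl
indicator≤1 false = z≤n

infixr 5 _==_
_==_ : Bool → Bool → Bool
true == y = y
false == y = not y

==-trueʳ : ∀ x → (x == true) ≡ x
==-trueʳ true = refl
==-trueʳ false = refl

==-refl : ∀ x → (x == x) ≡ true
==-refl true = refl
==-refl false = refl

not-==-not : ∀ x y → (not x == not y) ≡ (x == y)
not-==-not true y = not-involutive y
not-==-not false y = refl

isEven-+ : ∀ m n → isEvenℕ (m + n) ≡ (isEvenℕ m == isEvenℕ n)
isEven-+ zero n = refl
isEven-+ (suc m) n rewrite isEven-+ m n with isEvenℕ m
... | true = refl
... | false = not-involutive (isEvenℕ n)

isEven-∸ : ∀ {m n} → n ≤ m → isEvenℕ (m ∸ n) ≡ (isEvenℕ m == isEvenℕ n)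
isEven-∸ {m} z≤n = sym (==-trueʳ (isEvenℕ m))
isEven-∸ (s≤s {n} {m} n≤m) = trans (isEven-∸ n≤m) (sym (not-==-not (isEvenℕ m) (isEvenℕ n)))

module _ {A : Set} where

  sum-map-+ : ∀ (f g : A → ℕ) xs →
              sum (map (λ x → f x + g x) xs) ≡ sum (map f xs) + sum (map g xs)
  sum-map-+ f g [] = refl
  sum-map-+ f g (x ∷ xs) rewrite sum-map-+ f g xs = interchange (f x) (g x) _ _

  sum-map-* : ∀ k (f : A → ℕ) xs → sum (map (λ x → k * f x) xs) ≡ k * sum (map f xs)
  sum-map-* k f [] = sym (*-zeroʳ k)
  sum-map-* k f (x ∷ xs) rewrite sum-map-* k f xs = sym (*-distribˡ-+ k (f x) _)

  sum-map-cong-∈ : ∀ {f g : A → ℕ} xs → (∀ {x} → x ∈ xs → f x ≡ g x) →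
                   sum (map f xs) ≡ sum (map g xs)
  sum-map-cong-∈ xs f≡g = cong sum (map-cong-local (All.tabulate f≡g))

  sum-map-concatMap : ∀ {B : Set} (f : B → ℕ) (g : A → List B) xs →
                      sum (map f (concatMap g xs)) ≡ sum (map (λ x → sum (map f (g x))) xs)
  sum-map-concatMap f g [] = refl
  sum-map-concatMap f g (x ∷ xs) = begin
    sum (map f (g x ++ concatMap g xs))             ≡⟨ cong sum (map-++ f (g x) _) ⟩
    sum (map f (g x) ++ map f (concatMap g xs))     ≡⟨ sum-++ (map f (g x)) _ ⟩
    sum (map f (g x)) + sum (map f (concatMap g xs)) ≡⟨ cong (sum (map f (g x)) +_) (sum-map-concatMap f g xs) ⟩
    sum (map f (g x)) + sum (map (λ y → sum (map f (g y))) xs) ∎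
    where open ≡-Reasoning

  length-filter≡sum : ∀ (P : A → Bool) xs →
                      length (filter (λ x → T? (P x)) xs) ≡ sum (map (indicator ∘ P) xs)
  length-filter≡sum P [] = refl
  length-filter≡sum P (x ∷ xs) with P x
  ... | true = cong suc (length-filter≡sum P xs)
  ... | false = length-filter≡sum P xs

sum-applyUpTo-∷ʳ : ∀ (g : ℕ → ℕ) k → sum (applyUpTo g (suc k)) ≡ sum (applyUpTo g k) + g k
sum-applyUpTo-∷ʳ g k = begin
  sum (applyUpTo g (suc k))            ≡⟨ cong sum (applyUpTo-∷ʳ g k) ⟨
  sum (applyUpTo g k ++ [ g k ])       ≡⟨ sum-++ (applyUpTo g k) _ ⟩
  sum (applyUpTo g k) + (g k + 0)      ≡⟨ cong (sum (applyUpTo g k) +_) (+-identityʳ (g k)) ⟩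
  sum (applyUpTo g k) + g k            ∎
  where open ≡-Reasoning

sum-applyUpTo-cong : ∀ {g h : ℕ → ℕ} k → (∀ {p} → p < k → g p ≡ h p) →
                     sum (applyUpTo g k) ≡ sum (applyUpTo h k)
sum-applyUpTo-cong zero g≡h = refl
sum-applyUpTo-cong (suc k) g≡h =
  cong₂ _+_ (g≡h z<s) (sum-applyUpTo-cong k (λ p<k → g≡h (s<s p<k)))

sum-applyUpTo-zero : ∀ {g : ℕ → ℕ} k → (∀ {p} → p < k → g p ≡ 0) → sum (applyUpTo g k) ≡ 0
sum-applyUpTo-zero zero g≡0 = refl
sum-applyUpTo-zero (suc k) g≡0 =
  cong₂ _+_ (g≡0 z<s) (sum-applyUpTo-zero k (λ p<k → g≡0 (s<s p<k)))

sum-applyUpTo-single : ∀ {g : ℕ → ℕ} {r} k → r < k → (∀ {p} → p < k → p ≢ r → g p ≡ 0) →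
                       sum (applyUpTo g k) ≡ g r
sum-applyUpTo-single {g} {zero} (suc k) _ g≡0 = begin
  g 0 + sum (applyUpTo (g ∘ suc) k) ≡⟨ cong (g 0 +_) (sum-applyUpTo-zero k (λ p<k → g≡0 (s<s p<k) λ ())) ⟩
  g 0 + 0                           ≡⟨ +-identityʳ (g 0) ⟩
  g 0                               ∎
  where open ≡-Reasoning
sum-applyUpTo-single {g} {suc r} (suc k) r<k g≡0 =
  cong₂ _+_ (g≡0 z<s λ ())
            (sum-applyUpTo-single k (s≤s⁻¹ r<k) (λ p<k p≢r → g≡0 (s<s p<k) (p≢r ∘ suc-injective)))

sum-applyUpTo-+ : ∀ (g h : ℕ → ℕ) k →
                  sum (applyUpTo (λ p → g p + h p) k) ≡ sum (applyUpTo g k) + sum (applyUpTo h k)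
sum-applyUpTo-+ g h zero = refl
sum-applyUpTo-+ g h (suc k) rewrite sum-applyUpTo-+ (g ∘ suc) (h ∘ suc) k = interchange (g 0) (h 0) _ _

sum-applyUpTo-const : ∀ c k → sum (applyUpTo (λ _ → c) k) ≡ k * c
sum-applyUpTo-const c zero = refl
sum-applyUpTo-const c (suc k) = cong (c +_) (sum-applyUpTo-const c k)

module _ {A : Set} where

  length-++-∷ : ∀ (xs : List A) {y} ys → length (xs ++ y ∷ ys) ≡ suc (length (xs ++ ys))
  length-++-∷ xs ys = trans (length-++ xs) (trans (+-suc _ _) (cong suc (sym (length-++ xs))))

  ∈-++-∷⁻ : ∀ {z y : A} xs ys → z ≢ y → z ∈ xs ++ y ∷ ys → z ∈ xs ++ ys
  ∈-++-∷⁻ xs ys z≢y z∈ with Any.++⁻ xs z∈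
  ... | inj₁ z∈xs = Any.++⁺ˡ z∈xs
  ... | inj₂ (here z≡y) = ⊥-elim (z≢y z≡y)
  ... | inj₂ (there z∈ys) = Any.++⁺ʳ xs z∈ys

  unique-⊆⇒length≤ : ∀ {xs ys : List A} → Unique xs → (∀ {z} → z ∈ xs → z ∈ ys) →
                     length xs ≤ length ys
  unique-⊆⇒length≤ {[]} _ _ = z≤n
  unique-⊆⇒length≤ {x ∷ xs} (x∉xs ∷ xs!) xs⊆ys with ∈-∃++ (xs⊆ys (here refl))
  ... | ys₁ , ys₂ , refl = subst (suc (length xs) ≤_) (sym (length-++-∷ ys₁ ys₂))
    (s≤s (unique-⊆⇒length≤ xs! λ z∈xs →
      ∈-++-∷⁻ ys₁ ys₂ (λ z≡x → All.lookup x∉xs z∈xs (sym z≡x)) (xs⊆ys (there z∈xs))))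

  unique-++-∷⁺ : ∀ {y : A} xs ys → All (y ≢_) (xs ++ ys) → Unique (xs ++ ys) → Unique (xs ++ y ∷ ys)
  unique-++-∷⁺ [] ys y∉ys ys! = y∉ys ∷ ys!
  unique-++-∷⁺ (x ∷ xs) ys (y≢x ∷ y∉) (x∉ ∷ xs!) =
    let x∉xs , x∉ys = All.++⁻ xs x∉ in
    All.++⁺ x∉xs ((y≢x ∘ sym) ∷ x∉ys) ∷ unique-++-∷⁺ xs ys y∉ xs!

  unique-++-∷⁻ : ∀ {y : A} xs ys → Unique (xs ++ y ∷ ys) → All (y ≢_) (xs ++ ys) × Unique (xs ++ ys)
  unique-++-∷⁻ [] ys (y∉ys ∷ ys!) = y∉ys , ys!
  unique-++-∷⁻ (x ∷ xs) ys (x∉ ∷ xs!)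
    with x∉xs , x≢y ∷ x∉ys ← All.++⁻ xs x∉
    with y∉ , xs++ys! ← unique-++-∷⁻ xs ys xs!
    = ((x≢y ∘ sym) ∷ y∉) , All.++⁺ x∉xs x∉ys ∷ xs++ys!

  ++-∷-injective : ∀ {y : A} xs ys xs′ ys′ → All (_≢ y) xs → All (_≢ y) xs′ →
                   xs ++ y ∷ ys ≡ xs′ ++ y ∷ ys′ → xs ≡ xs′ × ys ≡ ys′
  ++-∷-injective [] ys [] ys′ _ _ refl = refl , refl
  ++-∷-injective [] ys (x′ ∷ xs′) ys′ _ (x′≢y ∷ _) refl = ⊥-elim (x′≢y refl)
  ++-∷-injective (x ∷ xs) ys [] ys′ (x≢y ∷ _) _ refl = ⊥-elim (x≢y refl)
  ++-∷-injective (x ∷ xs) ys (x′ ∷ xs′) ys′ (_ ∷ xs≢y) (_ ∷ xs′≢y) eq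
    with refl , eq′ ← ∷-injective eq
    with refl , refl ← ++-∷-injective xs ys xs′ ys′ xs≢y xs′≢y eq′ = refl , refl

  unique-concatMap⁺ : ∀ {B : Set} (f : A → List B) {xs} → Unique xs →
                      (∀ {x} → x ∈ xs → Unique (f x)) →
                      (∀ {x y z} → x ∈ xs → y ∈ xs → z ∈ f x → z ∈ f y → x ≡ y) →
                      Unique (concatMap f xs)
  unique-concatMap⁺ f {[]} _ _ _ = []
  unique-concatMap⁺ f {x ∷ xs} (x∉xs ∷ xs!) f! f-disjoint =
    Unique.++⁺ (f! (here refl))
               (unique-concatMap⁺ f xs! (f! ∘ there) (λ x∈ y∈ → f-disjoint (there x∈) (there y∈)))
               disjoint
    where
    disjoint : ∀ {z} → ¬ (z ∈ f x × z ∈ concatMap f xs)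
    disjoint (z∈fx , z∈fxs) =
      let y , y∈xs , z∈fy = find (∈-concatMap⁻ f z∈fxs) in
      All.lookup x∉xs y∈xs (f-disjoint (here refl) (there y∈xs) z∈fx z∈fy)

length-take-≤ : ∀ {A : Set} {p} (xs : List A) → p ≤ length xs → length (take p xs) ≡ p
length-take-≤ {p = p} xs p≤n = trans (length-take p xs) (m≤n⇒m⊓n≡m p≤n)

-- Descents, inversions and the first ascending run

<ᵇ-true : ∀ {m n} → m < n → (m <ᵇ n) ≡ true
<ᵇ-true {zero} {suc n} _ = refl
<ᵇ-true {suc m} {suc n} (s≤s m<n) = <ᵇ-true m<n

<ᵇ-false : ∀ {m n} → n ≤ m → (m <ᵇ n) ≡ false
<ᵇ-false z≤n = refl
<ᵇ-false (s≤s n≤m) = <ᵇ-false n≤m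

<ᵇ≡false⇒≥ : ∀ m n → (m <ᵇ n) ≡ false → n ≤ m
<ᵇ≡false⇒≥ m zero _ = z≤n
<ᵇ≡false⇒≥ (suc m) (suc n) eq = s≤s (<ᵇ≡false⇒≥ m n eq)

descents : List ℕ → ℕ
descents [] = 0
descents (x ∷ []) = 0
descents (x ∷ y ∷ xs) = indicator (y <ᵇ x) + descents (y ∷ xs)

smallerCount : ℕ → List ℕ → ℕ
smallerCount x [] = 0
smallerCount x (y ∷ ys) = indicator (y <ᵇ x) + smallerCount x ys

inversions : List ℕ → ℕ
inversions [] = 0
inversions (x ∷ xs) = smallerCount x xs + inversions xs

firstRun : List ℕ → ℕ
firstRun [] = 0
firstRun (x ∷ []) = 1
firstRun (x ∷ y ∷ xs) = if y <ᵇ x then 1 else suc (firstRun (y ∷ xs))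

descents-++-max : ∀ {M} A B → All (_< M) A → descents (A ++ M ∷ B) ≡ descents A + descents (M ∷ B)
descents-++-max [] B _ = refl
descents-++-max (a ∷ []) B (a<M ∷ _) rewrite <ᵇ-false (<⇒≤ a<M) = refl
descents-++-max (a ∷ a′ ∷ A) B (_ ∷ A<M) =
  trans (cong (indicator (a′ <ᵇ a) +_) (descents-++-max (a′ ∷ A) B A<M))
        (sym (+-assoc (indicator (a′ <ᵇ a)) _ _))

descents-max-∷ : ∀ {M} B → All (_< M) B → 0 < length B → descents (M ∷ B) ≡ suc (descents B)
descents-max-∷ (b ∷ B) (b<M ∷ _) _ rewrite <ᵇ-true b<M = refl

descents-++-≥ : ∀ A B → descents A + descents B ≤ descents (A ++ B)
descents-++-≥ [] B = ≤-refl
descents-++-≥ (a ∷ []) [] = z≤n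
descents-++-≥ (a ∷ []) (b ∷ B) = m≤n+m (descents (b ∷ B)) (indicator (b <ᵇ a))
descents-++-≥ (a ∷ a′ ∷ A) B = begin
  indicator (a′ <ᵇ a) + descents (a′ ∷ A) + descents B   ≡⟨ +-assoc (indicator (a′ <ᵇ a)) _ _ ⟩
  indicator (a′ <ᵇ a) + (descents (a′ ∷ A) + descents B) ≤⟨ +-monoʳ-≤ (indicator (a′ <ᵇ a)) (descents-++-≥ (a′ ∷ A) B) ⟩
  indicator (a′ <ᵇ a) + descents ((a′ ∷ A) ++ B)         ∎
  where open ≤-Reasoning

descents-++-≤ : ∀ A B → descents (A ++ B) ≤ descents A + suc (descents B)
descents-++-≤ [] B = n≤1+n (descents B)
descents-++-≤ (a ∷ []) [] = z≤n
descents-++-≤ (a ∷ []) (b ∷ B) = +-monoˡ-≤ (descents (b ∷ B)) (indicator≤1 (b <ᵇ a))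
descents-++-≤ (a ∷ a′ ∷ A) B = begin
  indicator (a′ <ᵇ a) + descents ((a′ ∷ A) ++ B)               ≤⟨ +-monoʳ-≤ (indicator (a′ <ᵇ a)) (descents-++-≤ (a′ ∷ A) B) ⟩
  indicator (a′ <ᵇ a) + (descents (a′ ∷ A) + suc (descents B)) ≡⟨ +-assoc (indicator (a′ <ᵇ a)) _ _ ⟨
  indicator (a′ <ᵇ a) + descents (a′ ∷ A) + suc (descents B)   ∎
  where open ≤-Reasoning

smallerCount-++ : ∀ x A B → smallerCount x (A ++ B) ≡ smallerCount x A + smallerCount x B
smallerCount-++ x [] B = refl
smallerCount-++ x (a ∷ A) B rewrite smallerCount-++ x A B = sym (+-assoc (indicator (a <ᵇ x)) _ _)

smallerCount-all : ∀ {M} B → All (_< M) B → smallerCount M B ≡ length B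
smallerCount-all [] [] = refl
smallerCount-all (b ∷ B) (b<M ∷ B<M) rewrite <ᵇ-true b<M = cong suc (smallerCount-all B B<M)

smallerCount-below : ∀ {x} B → All (x ≤_) B → smallerCount x B ≡ 0
smallerCount-below [] [] = refl
smallerCount-below (b ∷ B) (x≤b ∷ x≤B) rewrite <ᵇ-false x≤b = smallerCount-below B x≤B

inversions-insert-max : ∀ {M} A B → All (_< M) A → All (_< M) B →
                        inversions (A ++ M ∷ B) ≡ inversions (A ++ B) + length B
inversions-insert-max [] B _ B<M rewrite smallerCount-all B B<M = +-comm (length B) (inversions B)
inversions-insert-max {M} (a ∷ A) B (a<M ∷ A<M) B<M
  rewrite smallerCount-++ a A (M ∷ B) | <ᵇ-false (<⇒≤ a<M) | smallerCount-++ a A B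
        | inversions-insert-max A B A<M B<M
  = sym (+-assoc (smallerCount a A + smallerCount a B) (inversions (A ++ B)) (length B))

ascending-lowerBound : ∀ x xs → descents (x ∷ xs) ≡ 0 → All (x ≤_) xs
ascending-lowerBound x [] _ = []
ascending-lowerBound x (y ∷ ys) asc with y <ᵇ x in y≮x
... | false = x≤y ∷ All.map (≤-trans x≤y) (ascending-lowerBound y ys asc)
  where x≤y = <ᵇ≡false⇒≥ y x y≮x

ascending⇒inversions≡0 : ∀ l → descents l ≡ 0 → inversions l ≡ 0
ascending⇒inversions≡0 [] _ = refl
ascending⇒inversions≡0 (x ∷ xs) asc =
  cong₂ _+_ (smallerCount-below xs (ascending-lowerBound x xs asc))
            (ascending⇒inversions≡0 xs (tail-ascending x xs asc))
  where
  tail-ascending : ∀ x xs → descents (x ∷ xs) ≡ 0 → descents xs ≡ 0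
  tail-ascending x [] _ = refl
  tail-ascending x (y ∷ ys) asc = m+n≡0⇒n≡0 (indicator (y <ᵇ x)) asc

firstRun-insert-max : ∀ {M} A B → All (_< M) A → All (_< M) B → descents A ≡ 0 →
                      firstRun (A ++ M ∷ B) ≡ suc (length A)
firstRun-insert-max [] [] _ _ _ = refl
firstRun-insert-max [] (b ∷ B) _ (b<M ∷ _) _ rewrite <ᵇ-true b<M = refl
firstRun-insert-max (a ∷ []) B (a<M ∷ _) B<M _ rewrite <ᵇ-false (<⇒≤ a<M) =
  cong suc (firstRun-insert-max [] B [] B<M refl)
firstRun-insert-max (a ∷ a′ ∷ A) B (_ ∷ A<M) B<M asc with a′ <ᵇ a
... | false = cong suc (firstRun-insert-max (a′ ∷ A) B A<M B<M asc)

firstRun-++ : ∀ A B → 1 ≤ descents A → firstRun (A ++ B) ≡ firstRun A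
firstRun-++ (a ∷ A) B = go a A
  where
  go : ∀ a A → 1 ≤ descents (a ∷ A) → firstRun (a ∷ A ++ B) ≡ firstRun (a ∷ A)
  go a (a′ ∷ A) desc with a′ <ᵇ a
  ... | true = refl
  ... | false = cong suc (go a′ A desc)

descents-take-≤firstRun : ∀ p l → p ≤ firstRun l → descents (take p l) ≡ 0
descents-take-≤firstRun zero l _ = refl
descents-take-≤firstRun (suc p) [] _ = refl
descents-take-≤firstRun (suc p) (x ∷ l) = go p x l
  where
  go : ∀ p x l → suc p ≤ firstRun (x ∷ l) → descents (take (suc p) (x ∷ l)) ≡ 0
  go zero x l _ = refl
  go (suc p) x [] _ = refl
  go (suc p) x (y ∷ l) p≤r with y <ᵇ x
  ... | true = ⊥-elim (<-irrefl refl (≤-trans (s≤s (s≤s z≤n)) p≤r))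
  ... | false = go p y l (s≤s⁻¹ p≤r)

descents-take->firstRun : ∀ p l → firstRun l < p → p ≤ length l → 1 ≤ descents (take p l)
descents-take->firstRun (suc p) (x ∷ l) = go p x l
  where
  go : ∀ p x l → firstRun (x ∷ l) < suc p → suc p ≤ length (x ∷ l) → 1 ≤ descents (take (suc p) (x ∷ l))
  go zero x [] (s≤s ()) _
  go (suc p) x [] _ (s≤s ())
  go zero x (y ∷ l) r<p _ with y <ᵇ x
  ... | true = ⊥-elim (<-irrefl refl r<p)
  ... | false = ⊥-elim (<-irrefl refl (≤-trans r<p (s≤s z≤n)))
  go (suc p) x (y ∷ l) r<p p≤n with y <ᵇ x
  ... | true = s≤s z≤n
  ... | false = go p y l (s≤s⁻¹ r<p) (s≤s⁻¹ p≤n)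

descents-drop-<firstRun : ∀ p l → p < firstRun l → descents (drop p l) ≡ descents l
descents-drop-<firstRun zero l _ = refl
descents-drop-<firstRun (suc p) (x ∷ []) (s≤s ())
descents-drop-<firstRun (suc p) (x ∷ y ∷ l) p<r with y <ᵇ x
... | true = ⊥-elim (<-irrefl refl (≤-trans (s≤s (s≤s z≤n)) p<r))
... | false = descents-drop-<firstRun p (y ∷ l) (s≤s⁻¹ p<r)

descents-drop-firstRun : ∀ l → firstRun l < length l → descents l ≡ suc (descents (drop (firstRun l) l))
descents-drop-firstRun (x ∷ l) = go x l
  where
  go : ∀ x l → firstRun (x ∷ l) < suc (length l) →
       descents (x ∷ l) ≡ suc (descents (drop (firstRun (x ∷ l)) (x ∷ l)))
  go x [] (s≤s ())
  go x (y ∷ l) r<n with y <ᵇ x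
  ... | true = refl
  ... | false = go y l (s≤s⁻¹ r<n)

firstRun<length : ∀ l → 1 ≤ descents l → firstRun l < length l
firstRun<length (x ∷ l) = go x l
  where
  go : ∀ x l → 1 ≤ descents (x ∷ l) → firstRun (x ∷ l) < suc (length l)
  go x (y ∷ l) desc with y <ᵇ x
  ... | true = s≤s (s≤s z≤n)
  ... | false = s≤s (go y l desc)

-- Inserting a new maximum

insertAt : ℕ → ℕ → List ℕ → List ℕ
insertAt p M l = take p l ++ M ∷ drop p l

-- Lists with two or more descents are sent to nothing: inserting larger entries never removes a
-- descent, so they never contribute again.
data State : Set where
  ascending  : State
  oneDescent : (evenInversions evenFirstRun : Bool) → State

classify : (descents inversions firstRun : ℕ) → Maybe State
classify zero _ _ = just ascending
classify (suc zero) i r = just (oneDescent (isEvenℕ i) (isEvenℕ r))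
classify (suc (suc _)) _ _ = nothing

classify-cong : ∀ {d d′ i i′ r r′} → d ≡ d′ → i ≡ i′ → (d ≡ 1 → r ≡ r′) →
                classify d i r ≡ classify d′ i′ r′
classify-cong {zero} refl refl _ = refl
classify-cong {suc zero} refl refl r≡r′ = cong (λ r → just (oneDescent _ (isEvenℕ r))) (r≡r′ refl)
classify-cong {suc (suc _)} refl refl _ = refl

state : List ℕ → Maybe State
state l = classify (descents l) (inversions l) (firstRun l)

weight : (State → ℕ) → List ℕ → ℕ
weight F l = maybe F 0 (state l)

-- Inserting a new maximum into an ascending list of length m at p < m gives one descent, m − p inversions and a first run
-- of length p + 1. In a list with one descent only the insertions at the end of the first run
-- (adding m − r inversions, r the run length) and at the very end keep a single descent.
transfer : ℕ → (State → ℕ) → State → ℕ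
transfer m F ascending =
  sum (applyUpTo (λ p → F (oneDescent (isEvenℕ (m ∸ p)) (isEvenℕ (suc p)))) m) + F ascending
transfer m F (oneDescent e f) = F (oneDescent (e == (isEvenℕ m == f)) (not f)) + F (oneDescent e f)

insertions : ℕ → List ℕ → List (List ℕ)
insertions M l = applyUpTo (λ p → insertAt p M l) (suc (length l))

module _ {M : ℕ} {l : List ℕ} (l<M : All (_< M) l) where

  private
    n = length l
    i = inversions l
    r = firstRun l

    split≥ : ∀ p → descents (take p l) + descents (drop p l) ≤ descents l
    split≥ p = subst (λ l′ → descents (take p l) + descents (drop p l) ≤ descents l′)
                     (take++drop≡id p l) (descents-++-≥ (take p l) (drop p l))

    split≤ : ∀ p → descents l ≤ descents (take p l) + suc (descents (drop p l))
    split≤ p = subst (λ l′ → descents l′ ≤ descents (take p l) + suc (descents (drop p l)))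
                     (take++drop≡id p l) (descents-++-≤ (take p l) (drop p l))

  descents-insertAt : ∀ p → p < n →
                      descents (insertAt p M l) ≡ descents (take p l) + suc (descents (drop p l))
  descents-insertAt p p<n =
    trans (descents-++-max (take p l) (drop p l) (All.take⁺ p l<M))
          (cong (descents (take p l) +_) (descents-max-∷ (drop p l) (All.drop⁺ p l<M) drop-nonempty))
    where
    drop-nonempty : 0 < length (drop p l)
    drop-nonempty = subst (0 <_) (sym (length-drop p l)) (m<n⇒0<n∸m p<n)

  inversions-insertAt : ∀ p → inversions (insertAt p M l) ≡ inversions l + (n ∸ p)
  inversions-insertAt p = begin
    inversions (take p l ++ M ∷ drop p l)
      ≡⟨ inversions-insert-max (take p l) (drop p l) (All.take⁺ p l<M) (All.drop⁺ p l<M) ⟩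
    inversions (take p l ++ drop p l) + length (drop p l)
      ≡⟨ cong₂ _+_ (cong inversions (take++drop≡id p l)) (length-drop p l) ⟩
    inversions l + (n ∸ p) ∎
    where open ≡-Reasoning

  firstRun-insertAt : ∀ p → p ≤ n → descents (take p l) ≡ 0 → firstRun (insertAt p M l) ≡ suc p
  firstRun-insertAt p p≤n asc = begin
    firstRun (take p l ++ M ∷ drop p l)
      ≡⟨ firstRun-insert-max (take p l) (drop p l) (All.take⁺ p l<M) (All.drop⁺ p l<M) asc ⟩
    suc (length (take p l))
      ≡⟨ cong suc (length-take-≤ l p≤n) ⟩
    suc p ∎
    where open ≡-Reasoning

  state-insertAt-oneDescent : ∀ p → p < n → descents (take p l) ≡ 0 → descents (drop p l) ≡ 0 →
    state (insertAt p M l) ≡ just (oneDescent (isEvenℕ (inversions l + (n ∸ p))) (isEvenℕ (suc p)))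
  state-insertAt-oneDescent p p<n asc₁ asc₂ =
    classify-cong (trans (descents-insertAt p p<n) (cong₂ (λ d₁ d₂ → d₁ + suc d₂) asc₁ asc₂))
                  (inversions-insertAt p) (λ _ → firstRun-insertAt p (<⇒≤ p<n) asc₁)

  state-insertAt-nothing : ∀ p → p < n → 1 ≤ descents (take p l) + descents (drop p l) →
                           state (insertAt p M l) ≡ nothing
  state-insertAt-nothing p p<n desc =
    trans (classify-cong (trans (descents-insertAt p p<n) (+-suc _ _)) refl (λ _ → refl)) (twoDescents desc)
    where
    twoDescents : ∀ {d i r} → 1 ≤ d → classify (suc d) i r ≡ nothing
    twoDescents (s≤s _) = refl

  state-append-max : state (l ++ [ M ]) ≡ state l
  state-append-max = classify-cong descents-append inversions-append λ d≡1 →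
    firstRun-++ l [ M ] (≤-reflexive (sym (trans (sym descents-append) d≡1)))
    where
    descents-append : descents (l ++ [ M ]) ≡ descents l
    descents-append = trans (descents-++-max l [] l<M) (+-identityʳ (descents l))
    inversions-append : inversions (l ++ [ M ]) ≡ inversions l
    inversions-append = trans (inversions-insert-max l [] l<M [])
                              (trans (+-identityʳ _) (cong inversions (++-identityʳ l)))

  insertAt-weights-ascending : descents l ≡ 0 → ∀ F →
    sum (applyUpTo (λ p → weight F (insertAt p M l)) n) ≡
    sum (applyUpTo (λ p → F (oneDescent (isEvenℕ (n ∸ p)) (isEvenℕ (suc p)))) n)
  insertAt-weights-ascending asc F = sum-applyUpTo-cong n λ {p} p<n →
    let split≡0 = n≤0⇒n≡0 (subst (descents (take p l) + descents (drop p l) ≤_) asc (split≥ p)) in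
    cong (maybe F 0) (begin
      state (insertAt p M l)
        ≡⟨ state-insertAt-oneDescent p p<n (m+n≡0⇒m≡0 (descents (take p l)) split≡0)
                                           (m+n≡0⇒n≡0 (descents (take p l)) split≡0) ⟩
      just (oneDescent (isEvenℕ (i + (n ∸ p))) (isEvenℕ (suc p)))
        ≡⟨ cong (λ i → just (oneDescent (isEvenℕ (i + (n ∸ p))) (isEvenℕ (suc p)))) (ascending⇒inversions≡0 l asc) ⟩
      just (oneDescent (isEvenℕ (n ∸ p)) (isEvenℕ (suc p))) ∎)
    where open ≡-Reasoning

  insertAt-weights-oneDescent : descents l ≡ 1 → ∀ F →
    sum (applyUpTo (λ p → weight F (insertAt p M l)) n) ≡
    F (oneDescent (isEvenℕ i == (isEvenℕ n == isEvenℕ r)) (not (isEvenℕ r)))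
  insertAt-weights-oneDescent one F = begin
    sum (applyUpTo (λ p → weight F (insertAt p M l)) n)
      ≡⟨ sum-applyUpTo-single n r<n vanishes ⟩
    maybe F 0 (state (insertAt r M l))
      ≡⟨ cong (maybe F 0) (state-insertAt-oneDescent r r<n
           (descents-take-≤firstRun r l ≤-refl) (suc-injective (trans (sym (descents-drop-firstRun l r<n)) one))) ⟩
    F (oneDescent (isEvenℕ (i + (n ∸ r))) (not (isEvenℕ r)))
      ≡⟨ cong (λ e → F (oneDescent e (not (isEvenℕ r))))
              (trans (isEven-+ i (n ∸ r)) (cong (isEvenℕ i ==_) (isEven-∸ (<⇒≤ r<n)))) ⟩
    F (oneDescent (isEvenℕ i == (isEvenℕ n == isEvenℕ r)) (not (isEvenℕ r))) ∎
    where
    open ≡-Reasoning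
    r<n : r < n
    r<n = firstRun<length l (≤-reflexive (sym one))
    extraDescent : ∀ {p} → p < n → p ≢ r → 1 ≤ descents (take p l) + descents (drop p l)
    extraDescent {p} p<n p≢r with <-cmp p r
    ... | tri< p<r _ _ = ≤-trans (≤-reflexive (sym (trans (descents-drop-<firstRun p l p<r) one))) (m≤n+m _ _)
    ... | tri≈ _ p≡r _ = ⊥-elim (p≢r p≡r)
    ... | tri> _ _ r<p = ≤-trans (descents-take->firstRun p l r<p (<⇒≤ p<n)) (m≤m+n _ _)
    vanishes : ∀ {p} → p < n → p ≢ r → weight F (insertAt p M l) ≡ 0
    vanishes p<n p≢r = cong (maybe F 0) (state-insertAt-nothing _ p<n (extraDescent p<n p≢r))

  insertAt-weights-twoDescents : 2 ≤ descents l → ∀ F →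
    sum (applyUpTo (λ p → weight F (insertAt p M l)) n) ≡ 0
  insertAt-weights-twoDescents two F = sum-applyUpTo-zero n λ {p} p<n →
    cong (maybe F 0) (state-insertAt-nothing p p<n (splitHasDescent p))
    where
    splitHasDescent : ∀ p → 1 ≤ descents (take p l) + descents (drop p l)
    splitHasDescent p = s≤s⁻¹ (≤-trans two (≤-trans (split≤ p) (≤-reflexive (+-suc _ _))))

  weight-insertions : ∀ F → sum (map (weight F) (insertions M l)) ≡ weight (transfer n F) l
  weight-insertions F = begin
    sum (map (weight F) (insertions M l))
      ≡⟨ cong sum (map-applyUpTo (λ p → insertAt p M l) (weight F) (suc n)) ⟩
    sum (applyUpTo G (suc n))
      ≡⟨ sum-applyUpTo-∷ʳ G n ⟩
    sum (applyUpTo G n) + weight F (insertAt n M l)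
      ≡⟨ cong (λ l′ → sum (applyUpTo G n) + weight F l′) insertAt-end ⟩
    sum (applyUpTo G n) + weight F (l ++ [ M ])
      ≡⟨ cong (λ s → sum (applyUpTo G n) + maybe F 0 s) state-append-max ⟩
    sum (applyUpTo G n) + weight F l
      ≡⟨ by-descents (descents l) refl ⟩
    weight (transfer n F) l ∎
    where
    open ≡-Reasoning
    G : ℕ → ℕ
    G p = weight F (insertAt p M l)
    insertAt-end : insertAt n M l ≡ l ++ [ M ]
    insertAt-end = cong₂ (λ A B → A ++ M ∷ B) (take-all n l ≤-refl) (drop-all n l ≤-refl)
    by-descents : ∀ d → descents l ≡ d →
                  sum (applyUpTo G n) + maybe F 0 (classify d i r) ≡ maybe (transfer n F) 0 (classify d i r)
    by-descents zero asc = cong (_+ F ascending) (insertAt-weights-ascending asc F)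
    by-descents (suc zero) one =
      cong (_+ F (oneDescent (isEvenℕ i) (isEvenℕ r))) (insertAt-weights-oneDescent one F)
    by-descents (suc (suc _)) two =
      trans (+-identityʳ _) (insertAt-weights-twoDescents (subst (2 ≤_) (sym two) (s≤s (s≤s z≤n))) F)

length-insertAt : ∀ p M l → length (insertAt p M l) ≡ suc (length l)
length-insertAt p M l = trans (length-++-∷ (take p l) (drop p l)) (cong (suc ∘ length) (take++drop≡id p l))

insertAt-length-++ : ∀ {M} A B → insertAt (length A) M (A ++ B) ≡ A ++ M ∷ B
insertAt-length-++ [] B = refl
insertAt-length-++ (a ∷ A) B = cong (a ∷_) (insertAt-length-++ A B)

insertAt-injective : ∀ {M l l′ p q} → All (_< M) l → All (_< M) l′ → p ≤ length l → q ≤ length l′ →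
                     insertAt p M l ≡ insertAt q M l′ → p ≡ q × l ≡ l′
insertAt-injective {M} {l} {l′} {p} {q} l<M l′<M p≤n q≤n eq
  with take≡ , drop≡ ← ++-∷-injective (take p l) (drop p l) (take q l′) (drop q l′)
                         (All.map <⇒≢ (All.take⁺ p l<M)) (All.map <⇒≢ (All.take⁺ q l′<M)) eq
  = trans (sym (length-take-≤ l p≤n)) (trans (cong length take≡) (length-take-≤ l′ q≤n))
  , trans (sym (take++drop≡id p l)) (trans (cong₂ _++_ take≡ drop≡) (take++drop≡id q l′))

IsPerm : ℕ → List ℕ → Set
IsPerm n l = length l ≡ n × All (_< n) l × Unique l

isPerm-insertAt : ∀ {m l} p → IsPerm m l → IsPerm (suc m) (insertAt p m l)
isPerm-insertAt {m} {l} p (len , l<m , l!) =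
  trans (length-insertAt p m l) (cong suc len) ,
  All.++⁺ (All.take⁺ p l<1+m) (≤-refl ∷ All.drop⁺ p l<1+m) ,
  unique-++-∷⁺ (take p l) (drop p l) (split {All (m ≢_)} (All.map (≢-sym ∘ <⇒≢) l<m))
                                     (split {Unique} l!)
  where
  l<1+m = All.map m<n⇒m<1+n l<m
  split : ∀ {P : List ℕ → Set} → P l → P (take p l ++ drop p l)
  split {P} = subst P (sym (take++drop≡id p l))

max∈perm : ∀ {m z} → IsPerm (suc m) z → m ∈ z
max∈perm {m} {z} (len , z<1+m , z!) with m ∈? z
... | yes m∈z = m∈z
... | no m∉z = ⊥-elim (1+n≰n (subst (_≤ m) len (subst (length z ≤_) (length-upTo m) z≤m)))
  where
  z<m : All (_< m) z
  z<m = All.tabulate λ x∈z → ≤∧≢⇒< (s≤s⁻¹ (All.lookup z<1+m x∈z)) (λ x≡m → m∉z (subst (_∈ z) x≡m x∈z))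
  z≤m : length z ≤ length (upTo m)
  z≤m = unique-⊆⇒length≤ z! (∈-upTo⁺ ∘ All.lookup z<m)

insertionPerms : ℕ → List (List ℕ)
insertionPerms zero = [ [] ]
insertionPerms (suc m) = concatMap (insertions m) (insertionPerms m)

insertionPerms⇒IsPerm : ∀ n {z} → z ∈ insertionPerms n → IsPerm n z
insertionPerms⇒IsPerm zero (here refl) = refl , [] , []
insertionPerms⇒IsPerm (suc m) z∈
  with l , l∈ , z∈ins ← find (∈-concatMap⁻ (insertions m) z∈)
  with p , _ , refl ← ∈-applyUpTo⁻ (λ p → insertAt p m l) z∈ins
  = isPerm-insertAt p (insertionPerms⇒IsPerm m l∈)

IsPerm⇒insertionPerms : ∀ n {z} → IsPerm n z → z ∈ insertionPerms n
IsPerm⇒insertionPerms zero {[]} _ = here refl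
IsPerm⇒insertionPerms (suc m) z-perm@(len , z<1+m , z!)
  with A , B , refl ← ∈-∃++ (max∈perm z-perm)
  with m∉ , A++B! ← unique-++-∷⁻ A B z!
  = ∈-concatMap⁺ (insertions m) (lose A++B∈ z∈insertions)
  where
  A++B<1+m : All (_< suc m) (A ++ B)
  A++B<1+m with A<1+m , _ ∷ B<1+m ← All.++⁻ A z<1+m = All.++⁺ A<1+m B<1+m
  A++B<m : All (_< m) (A ++ B)
  A++B<m = All.zipWith (λ (x<1+m , m≢x) → ≤∧≢⇒< (s≤s⁻¹ x<1+m) (≢-sym m≢x)) (A++B<1+m , m∉)
  A++B∈ : A ++ B ∈ insertionPerms m
  A++B∈ = IsPerm⇒insertionPerms m (suc-injective (trans (sym (length-++-∷ A B)) len) , A++B<m , A++B!)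
  z∈insertions : A ++ m ∷ B ∈ insertions m (A ++ B)
  z∈insertions = subst (_∈ insertions m (A ++ B)) (insertAt-length-++ A B)
                       (∈-applyUpTo⁺ (λ p → insertAt p m (A ++ B)) (s≤s (length-++-≤ˡ A)))

insertionPerms-unique : ∀ n → Unique (insertionPerms n)
insertionPerms-unique zero = [] ∷ []
insertionPerms-unique (suc m) =
  unique-concatMap⁺ (insertions m) (insertionPerms-unique m) insertions-unique insertions-disjoint
  where
  below : ∀ {l} → l ∈ insertionPerms m → All (_< m) l
  below l∈ = proj₁ (proj₂ (insertionPerms⇒IsPerm m l∈))
  insertions-unique : ∀ {l} → l ∈ insertionPerms m → Unique (insertions m l)
  insertions-unique l∈ = Unique.applyUpTo⁺₁ _ _ λ p<q q≤n eq →
    <⇒≢ p<q (proj₁ (insertAt-injective (below l∈) (below l∈)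
                                       (≤-trans (<⇒≤ p<q) (s≤s⁻¹ q≤n)) (s≤s⁻¹ q≤n) eq))
  insertions-disjoint : ∀ {l l′ z} → l ∈ insertionPerms m → l′ ∈ insertionPerms m →
                        z ∈ insertions m l → z ∈ insertions m l′ → l ≡ l′
  insertions-disjoint {l} {l′} l∈ l′∈ z∈ z∈′
    with p , p≤n , refl ← ∈-applyUpTo⁻ (λ p → insertAt p m l) z∈
    with q , q≤n , eq ← ∈-applyUpTo⁻ (λ q → insertAt q m l′) z∈′
    = proj₂ (insertAt-injective (below l∈) (below l′∈) (s≤s⁻¹ p≤n) (s≤s⁻¹ q≤n) eq)

-- Counting by states

total : ℕ → (State → ℕ) → ℕ
total n F = sum (map (weight F) (insertionPerms n))

total-suc : ∀ m F → total (suc m) F ≡ total m (transfer m F)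
total-suc m F = trans (sum-map-concatMap (weight F) (insertions m) (insertionPerms m))
  (sum-map-cong-∈ (insertionPerms m) λ {l} l∈ →
    let len , l<m , _ = insertionPerms⇒IsPerm m l∈ in
    trans (weight-insertions l<m F) (cong (λ k → weight (transfer k F) l) len))

total-cong : ∀ n {F G} → (∀ c → F c ≡ G c) → total n F ≡ total n G
total-cong n {F} {G} F≡G = cong sum (map-cong weight≡ (insertionPerms n))
  where
  weight≡ : ∀ l → weight F l ≡ weight G l
  weight≡ l with state l
  ... | just c = F≡G c
  ... | nothing = refl

total-+ : ∀ n F G → total n (λ c → F c + G c) ≡ total n F + total n G
total-+ n F G =
  trans (cong sum (map-cong weight-+ (insertionPerms n))) (sum-map-+ (weight F) (weight G) (insertionPerms n))
  where
  weight-+ : ∀ l → weight (λ c → F c + G c) l ≡ weight F l + weight G l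
  weight-+ l with state l
  ... | just c = refl
  ... | nothing = refl

total-* : ∀ n k F → total n (λ c → k * F c) ≡ k * total n F
total-* n k F =
  trans (cong sum (map-cong weight-* (insertionPerms n))) (sum-map-* k (weight F) (insertionPerms n))
  where
  weight-* : ∀ l → weight (λ c → k * F c) l ≡ k * weight F l
  weight-* l with state l
  ... | just c = refl
  ... | nothing = sym (*-zeroʳ k)

total-combine : ∀ n {F G H} → (∀ c → F c + G c ≡ H c) → total n F + total n G ≡ total n H
total-combine n {F} {G} F+G≡H = trans (sym (total-+ n F G)) (total-cong n F+G≡H)

atAscending : State → ℕ
atAscending ascending = 1
atAscending (oneDescent _ _) = 0

even : State → ℕ
even ascending = 1
even (oneDescent e _) = indicator e

total-atAscending : ∀ n → total n atAscending ≡ 1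
total-atAscending zero = refl
total-atAscending (suc m) =
  trans (total-suc m atAscending) (trans (total-cong m fixed) (total-atAscending m))
  where
  fixed : ∀ c → transfer m atAscending c ≡ atAscending c
  fixed ascending = cong (_+ 1) (trans (sum-applyUpTo-const 0 m) (*-zeroʳ m))
  fixed (oneDescent _ _) = refl

total-one : ∀ n → total n (λ _ → 1) + n ≡ 2 ^ n
total-one zero = refl
total-one (suc m) = begin
  total (suc m) one + (1 + m)
    ≡⟨ cong₂ (λ t a → t + (a + m)) (total-suc m one) (sym (total-atAscending m)) ⟩
  total m (transfer m one) + (total m atAscending + m)
    ≡⟨ +-assoc (total m (transfer m one)) _ m ⟨
  total m (transfer m one) + total m atAscending + m
    ≡⟨ cong (_+ m) (total-combine m pointwise) ⟩
  total m (λ c → 2 * 1 + m * atAscending c) + m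
    ≡⟨ cong (_+ m) (total-+ m (λ _ → 2) (λ c → m * atAscending c)) ⟩
  total m (λ _ → 2) + total m (λ c → m * atAscending c) + m
    ≡⟨ cong₂ (λ a b → a + b + m) (total-* m 2 one)
             (trans (total-* m m atAscending) (cong (m *_) (total-atAscending m))) ⟩
  2 * total m one + m * 1 + m
    ≡⟨ arithmetic (total m one) m ⟩
  2 * (total m one + m)
    ≡⟨ cong (2 *_) (total-one m) ⟩
  2 * 2 ^ m ∎
  where
  open ≡-Reasoning
  one : State → ℕ
  one _ = 1
  pointwise : ∀ c → transfer m one c + atAscending c ≡ 2 * 1 + m * atAscending c
  pointwise ascending =
    trans (cong (λ s → s + 1 + 1) (sum-applyUpTo-const 1 m)) (trans (+-assoc (m * 1) 1 1) (+-comm (m * 1) 2))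
  pointwise (oneDescent _ _) = cong (2 +_) (sym (*-zeroʳ m))
  arithmetic : ∀ t m → 2 * t + m * 1 + m ≡ 2 * (t + m)
  arithmetic = solve-∀

evenDistances : ℕ → ℕ
evenDistances k = sum (applyUpTo (λ p → indicator (isEvenℕ (k ∸ p))) k)

evenDistances-+-suc : ∀ k → evenDistances k + evenDistances (suc k) ≡ k
evenDistances-+-suc zero = refl
evenDistances-+-suc (suc k) = begin
  (indicator x + evenDistances k) + (indicator (not x) + evenDistances (suc k))
    ≡⟨ interchange (indicator x) (evenDistances k) (indicator (not x)) (evenDistances (suc k)) ⟩
  (indicator x + indicator (not x)) + (evenDistances k + evenDistances (suc k))
    ≡⟨ cong₂ _+_ (indicator-not x) (evenDistances-+-suc k) ⟩
  suc k ∎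
  where
  open ≡-Reasoning
  x = not (isEvenℕ k)

transfer²-even : ∀ m c → transfer m (transfer (suc m) even) c + 2 * atAscending c ≡
                         2 * even c + 1 + 2 * m * atAscending c
transfer²-even m ascending = begin
  sum (applyUpTo (H ∘ inserted) m) + (evenDistances (suc m) + 1) + 2
    ≡⟨ cong (λ s → s + (evenDistances (suc m) + 1) + 2) inner-sum ⟩
  m * 1 + evenDistances m + (evenDistances (suc m) + 1) + 2
    ≡⟨ regroup m (evenDistances m) (evenDistances (suc m)) ⟩
  m * 1 + (evenDistances m + evenDistances (suc m)) + 3
    ≡⟨ cong (λ s → m * 1 + s + 3) (evenDistances-+-suc m) ⟩
  m * 1 + m + 3
    ≡⟨ finish m ⟩
  2 * 1 + 1 + 2 * m * 1 ∎
  where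
  open ≡-Reasoning
  H = transfer (suc m) even
  inserted : ℕ → State
  inserted p = oneDescent (isEvenℕ (m ∸ p)) (isEvenℕ (suc p))
  inner : ∀ {p} → p < m → H (inserted p) ≡ 1 + indicator (isEvenℕ (m ∸ p))
  inner {p} p<m = cong (λ e → indicator e + indicator (isEvenℕ (m ∸ p))) (begin
    isEvenℕ (m ∸ p) == (not (isEvenℕ m) == not (isEvenℕ p))
      ≡⟨ cong₂ _==_ (isEven-∸ (<⇒≤ p<m)) (not-==-not (isEvenℕ m) (isEvenℕ p)) ⟩
    (isEvenℕ m == isEvenℕ p) == (isEvenℕ m == isEvenℕ p)
      ≡⟨ ==-refl (isEvenℕ m == isEvenℕ p) ⟩
    true ∎)
  inner-sum : sum (applyUpTo (H ∘ inserted) m) ≡ m * 1 + evenDistances m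
  inner-sum = trans (sum-applyUpTo-cong m inner)
                    (trans (sum-applyUpTo-+ (λ _ → 1) (λ p → indicator (isEvenℕ (m ∸ p))) m)
                           (cong (_+ evenDistances m) (sum-applyUpTo-const 1 m)))
  regroup : ∀ m a b → m * 1 + a + (b + 1) + 2 ≡ m * 1 + (a + b) + 3
  regroup = solve-∀
  finish : ∀ m → m * 1 + m + 3 ≡ 2 * 1 + 1 + 2 * m * 1
  finish = solve-∀
transfer²-even m (oneDescent e f) = begin
  transfer m (transfer (suc m) even) (oneDescent e f) + 0 ≡⟨ +-identityʳ _ ⟩
  transfer m (transfer (suc m) even) (oneDescent e f)     ≡⟨ parity-cancels e f (isEvenℕ m) ⟩
  2 * indicator e + 1                                     ≡⟨ +-identityʳ _ ⟨
  2 * indicator e + 1 + 0                                 ≡⟨ cong (2 * indicator e + 1 +_) (*-zeroʳ (2 * m)) ⟨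
  2 * indicator e + 1 + 2 * m * 0                         ∎
  where
  open ≡-Reasoning
  parity-cancels : ∀ e f x → indicator ((e == (x == f)) == (not x == not f)) + indicator (e == (x == f))
                             + (indicator (e == (not x == f)) + indicator e) ≡ 2 * indicator e + 1
  parity-cancels true true true = refl
  parity-cancels true true false = refl
  parity-cancels true false true = refl
  parity-cancels true false false = refl
  parity-cancels false true true = refl
  parity-cancels false true false = refl
  parity-cancels false false true = refl
  parity-cancels false false false = refl

total-even-recurrence : ∀ m → total (2 + m) even + 4 ≡ 2 * total m even + 2 ^ m + (2 + m)
total-even-recurrence m = +-cancelʳ-≡ m _ _ (begin
  total (2 + m) even + 4 + m                ≡⟨ arithmetic₁ (total (2 + m) even) m ⟩
  total (2 + m) even + 2 * 1 + (2 + m)      ≡⟨ cong (_+ (2 + m)) two-steps ⟩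
  2 * t + o + 2 * m * 1 + (2 + m)           ≡⟨ arithmetic₂ t o m ⟩
  2 * t + (o + m) + (2 + m) + m             ≡⟨ cong (λ x → 2 * t + x + (2 + m) + m) (total-one m) ⟩
  2 * t + 2 ^ m + (2 + m) + m               ∎)
  where
  open ≡-Reasoning
  t = total m even
  o = total m (λ _ → 1)
  H₂ = transfer m (transfer (suc m) even)
  two-steps : total (2 + m) even + 2 * 1 ≡ 2 * t + o + 2 * m * 1
  two-steps = begin
    total (2 + m) even + 2 * 1
      ≡⟨ cong₂ (λ a b → a + 2 * b) (trans (total-suc (suc m) even) (total-suc m _))
                                   (sym (total-atAscending m)) ⟩
    total m H₂ + 2 * total m atAscending
      ≡⟨ cong (total m H₂ +_) (total-* m 2 atAscending) ⟨
    total m H₂ + total m (λ c → 2 * atAscending c)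
      ≡⟨ total-combine m (transfer²-even m) ⟩
    total m (λ c → 2 * even c + 1 + 2 * m * atAscending c)
      ≡⟨ total-+ m (λ c → 2 * even c + 1) (λ c → 2 * m * atAscending c) ⟩
    total m (λ c → 2 * even c + 1) + total m (λ c → 2 * m * atAscending c)
      ≡⟨ cong₂ _+_ (trans (total-+ m (λ c → 2 * even c) (λ _ → 1)) (cong (_+ o) (total-* m 2 even)))
                   (trans (total-* m (2 * m) atAscending) (cong (2 * m *_) (total-atAscending m))) ⟩
    2 * t + o + 2 * m * 1 ∎
  arithmetic₁ : ∀ T m → T + 4 + m ≡ T + 2 * 1 + (2 + m)
  arithmetic₁ = solve-∀
  arithmetic₂ : ∀ t o m → 2 * t + o + 2 * m * 1 + (2 + m) ≡ 2 * t + (o + m) + (2 + m) + m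
  arithmetic₂ = solve-∀

T-not-≡ᵇ : ∀ m n → T (not (m ≡ᵇ n)) ⇔ m ≢ n
T-not-≡ᵇ m n with m ≡ᵇ n in eq
... | true = mk⇔ (λ ()) (λ m≢n → m≢n (≡ᵇ⇒≡ m n (subst T (sym eq) _)))
... | false = mk⇔ (λ _ m≡n → subst T eq (≡⇒≡ᵇ m n m≡n)) _

module _ {n : ℕ} where

  distinctFrom⇒ : ∀ (x : Fin n) (ys : List (Fin n)) →
                  T (allB (λ y → not (toℕ x ≡ᵇ toℕ y)) ys) → All (toℕ x ≢_) (map toℕ ys)
  distinctFrom⇒ x [] _ = []
  distinctFrom⇒ x (y ∷ ys) t with x≢y , x∉ys ← Equivalence.to T-∧ t =
    Equivalence.to (T-not-≡ᵇ (toℕ x) (toℕ y)) x≢y ∷ distinctFrom⇒ x ys x∉ys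

  distinctFrom⇐ : ∀ (x : Fin n) (ys : List (Fin n)) →
                  All (toℕ x ≢_) (map toℕ ys) → T (allB (λ y → not (toℕ x ≡ᵇ toℕ y)) ys)
  distinctFrom⇐ x [] _ = _
  distinctFrom⇐ x (y ∷ ys) (x≢y ∷ x∉ys) =
    Equivalence.from T-∧ (Equivalence.from (T-not-≡ᵇ (toℕ x) (toℕ y)) x≢y , distinctFrom⇐ x ys x∉ys)

  distinct⇒unique : ∀ (xs : List (Fin n)) → T (distinct xs) → Unique (map toℕ xs)
  distinct⇒unique [] _ = []
  distinct⇒unique (x ∷ xs) t with x∉xs , xs! ← Equivalence.to T-∧ t =
    distinctFrom⇒ x xs x∉xs ∷ distinct⇒unique xs xs!

  unique⇒distinct : ∀ (xs : List (Fin n)) → Unique (map toℕ xs) → T (distinct xs)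
  unique⇒distinct [] _ = _
  unique⇒distinct (x ∷ xs) (x∉xs ∷ xs!) =
    Equivalence.from T-∧ (distinctFrom⇐ x xs x∉xs , unique⇒distinct xs xs!)

  words-complete : ∀ {k} (w : Vec (Fin n) k) → w ∈ words n k
  words-complete [] = here refl
  words-complete (x ∷ w) = ∈-concatMap⁺ _ (lose (∈-allFin x) (∈-map⁺ (x ∷_) (words-complete w)))

  words-unique : ∀ k → Unique (words n k)
  words-unique zero = [] ∷ []
  words-unique (suc k) = unique-concatMap⁺ _ (Unique.allFin⁺ n)
    (λ _ → Unique.map⁺ Vec.∷-injectiveʳ (words-unique k))
    λ _ _ z∈x z∈y → let _ , _ , z≡x∷w = ∈-map⁻ _ z∈x
                        _ , _ , z≡y∷w′ = ∈-map⁻ _ z∈y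
                    in Vec.∷-injectiveˡ (trans (sym z≡x∷w) z≡y∷w′)

toℕs : ∀ {n k} → Vec (Fin n) k → List ℕ
toℕs w = map toℕ (toList w)

toℕs-injective : ∀ {n k} {w w′ : Vec (Fin n) k} → toℕs w ≡ toℕs w′ → w ≡ w′
toℕs-injective {w = w} {w′} eq =
  trans (sym (Vec.cast-is-id refl w)) (Vec.toList-injective refl w w′ (map-injective toℕ-injective eq))

fromℕs : ∀ {n} (z : List ℕ) → All (_< n) z → Vec (Fin n) (length z)
fromℕs [] [] = []
fromℕs (x ∷ z) (x<n ∷ z<n) = fromℕ< x<n ∷ fromℕs z z<n

toℕs-fromℕs : ∀ {n} (z : List ℕ) (z<n : All (_< n) z) → toℕs (fromℕs z z<n) ≡ z
toℕs-fromℕs [] [] = refl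
toℕs-fromℕs (x ∷ z) (x<n ∷ z<n) = cong₂ _∷_ (toℕ-fromℕ< x<n) (toℕs-fromℕs z z<n)

perms⇒IsPerm : ∀ n {z} → z ∈ map toℕs (perms n) → IsPerm n z
perms⇒IsPerm n z∈ with w , w∈ , refl ← ∈-map⁻ toℕs z∈ =
  trans (length-map toℕ (toList w)) (Vec.length-toList w) ,
  All.map⁺ (All.tabulate (λ {x} _ → toℕ<n x)) ,
  distinct⇒unique (toList w) (proj₂ (∈-filter⁻ (λ w → T? (distinct (toList w))) {xs = words n n} w∈))

IsPerm⇒perms : ∀ n {z} → IsPerm n z → z ∈ map toℕs (perms n)
IsPerm⇒perms .(length z) {z} (refl , z<n , z!) =
  subst (_∈ map toℕs (perms (length z))) (toℕs-fromℕs z z<n)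
  (∈-map⁺ toℕs (∈-filter⁺ (λ w → T? (distinct (toList w))) (words-complete w)
                         (unique⇒distinct (toList w) (subst Unique (sym (toℕs-fromℕs z z<n)) z!))))
  where w = fromℕs z z<n

perms↭insertionPerms : ∀ n → map toℕs (perms n) ↭ insertionPerms n
perms↭insertionPerms n = ∼bag⇒↭ (unique∧set⇒bag
  (Unique.map⁺ toℕs-injective (Unique.filter⁺ _ (words-unique n)))
  (insertionPerms-unique n)
  (mk⇔ (IsPerm⇒insertionPerms n ∘ perms⇒IsPerm n) (IsPerm⇒perms n ∘ insertionPerms⇒IsPerm n)))

descentsL≡descents : ∀ {n} (xs : List (Fin n)) → descentsL xs ≡ descents (map toℕ xs)
descentsL≡descents [] = refl
descentsL≡descents (x ∷ []) = refl
descentsL≡descents (x ∷ y ∷ xs) =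
  cong₂ _+_ (if-indicator (toℕ y <ᵇ toℕ x)) (descentsL≡descents (y ∷ xs))
  where
  if-indicator : ∀ b → (if b then 1 else 0) ≡ indicator b
  if-indicator true = refl
  if-indicator false = refl

inversionsL≡inversions : ∀ {n} (xs : List (Fin n)) → inversionsL xs ≡ inversions (map toℕ xs)
inversionsL≡inversions [] = refl
inversionsL≡inversions (x ∷ xs) = cong₂ _+_ (smaller x xs) (inversionsL≡inversions xs)
  where
  smaller : ∀ x ys → length (filter (λ y → T? (toℕ y <ᵇ toℕ x)) ys) ≡ smallerCount (toℕ x) (map toℕ ys)
  smaller x [] = refl
  smaller x (y ∷ ys) with toℕ y <ᵇ toℕ x
  ... | true = cong suc (smaller x ys)
  ... | false = smaller x ys

weight-even : ∀ l → weight even l ≡ indicator ((descents l <ᵇ 2) ∧ isEvenℕ (inversions l))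
weight-even l with descents l in eq
... | zero rewrite ascending⇒inversions≡0 l eq = refl
... | suc zero = refl
... | suc (suc _) = refl

b≡total : ∀ n → b n ≡ total n even
b≡total n = begin
  length (filter (λ w → T? (evenGrassmannian w)) (perms n))
    ≡⟨ length-filter≡sum evenGrassmannian (perms n) ⟩
  sum (map (indicator ∘ evenGrassmannian) (perms n))
    ≡⟨ cong sum (map-cong weight-even-toℕs (perms n)) ⟨
  sum (map (weight even ∘ toℕs) (perms n))
    ≡⟨ cong sum (map-∘ (perms n)) ⟩
  sum (map (weight even) (map toℕs (perms n)))
    ≡⟨ sum-↭ (↭.map⁺ (weight even) (perms↭insertionPerms n)) ⟩
  total n even ∎
  where
  open ≡-Reasoning
  evenGrassmannian : Vec (Fin n) n → Bool
  evenGrassmannian w = isGrassmannian w ∧ isEvenPerm w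
  weight-even-toℕs : ∀ w → weight even (toℕs w) ≡ indicator (evenGrassmannian w)
  weight-even-toℕs w = trans (weight-even (toℕs w))
    (cong₂ (λ d i → indicator ((d <ᵇ 2) ∧ isEvenℕ i))
           (sym (descentsL≡descents (toList w))) (sym (inversionsL≡inversions (toList w))))

mainTheorem12 : (b 1 ≡ 1) × (b 2 ≡ 1) ×
    ((n : ℕ) → n > 2 → b n + 4 ≡ 2 * b (n ∸ 2) + 2 ^ (n ∸ 2) + n)
mainTheorem12 = refl , refl , recurrence
  where
  recurrence : (n : ℕ) → n > 2 → b n + 4 ≡ 2 * b (n ∸ 2) + 2 ^ (n ∸ 2) + n
  recurrence (suc (suc m)) _ rewrite b≡total (2 + m) | b≡total m = total-even-recurrence m
  recurrence (suc zero) (s≤s ())
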